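{- For $n=1,2,3,4$, there are no CS $n$-sets whose sum of entries is zero.
   Context: A CS-set is a finite multiset $\langle a_1,\dots,a_n\rangle$ of integers (repeated elements allowed, order irrelevant) such that $a_1^3+a_2^3+\cdots+a_n^3=(a_1+a_2+\cdots+a_n)^2$, where it is required that no $a_i$ equals $0$ and that the multiset does not contain both $k$ and $-k$ for any integer $k$. A CS $n$-set is a CS-set with exactly $n$ elements (counted with multiplicity). -}

module Defs where

open import Data.Nat using (ℕ)
open import Data.Integer using (ℤ; 0ℤ; _+_; _*_; -_)
open import Data.List using (List; foldr; map; length)
open import Data.List.Membership.Propositional using (_∈_)
open import Data.Product using (_×_)
open import Relation.Binary.PropositionalEquality using (_≡_; _≢_)
open import Relation.Nullary using (¬_)

-- A finite multiset of integers is represented by a list (order irrelevant;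
-- all conditions below are invariant under permutation).

sumℤ : List ℤ → ℤ
sumℤ = foldr _+_ 0ℤ

cube : ℤ → ℤ
cube x = x * x * x

square : ℤ → ℤ
square x = x * x

record IsCSSet (xs : List ℤ) : Set where
  field
    cubeSum   : sumℤ (map cube xs) ≡ square (sumℤ xs)
    nonzero   : ∀ {a} → a ∈ xs → a ≢ 0ℤ
    noOpposite : ∀ {a} → a ∈ xs → ¬ ((- a) ∈ xs)

IsCSnSet : (n : ℕ) → List ℤ → Set
IsCSnSet n xs = IsCSSet xs × length xs ≡ n

{-# OPTIONS --safe #-}
module Submission where

-- If the entries sum to zero, the CS condition forces their cubes to sum to zero too.
-- For at most four entries with zero sum the sum of cubes factors: a³ + b³ + c³ = 3abc
-- when a + b + c = 0, and a³ + b³ + c³ + d³ = 3(a + b)(a + c)(a + d) when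
-- a + b + c + d = 0. A vanishing factor is then a zero entry or a pair k, -k.

open import Defs
open import Data.Nat using (ℕ; _≤_; s≤s)
open import Data.Integer using (ℤ; 0ℤ; _+_; _*_; -_; +_)
open import Data.Integer.Properties using (i*j≡0⇒i≡0∨j≡0; +-identityʳ; +-0-abelianGroup)
open import Data.Integer.Tactic.RingSolver using (solve-∀)
open import Algebra.Properties.AbelianGroup +-0-abelianGroup using (inverseʳ-unique)
open import Data.List using (List; []; _∷_; length; map)
open import Data.List.Membership.Propositional using (_∈_)
open import Data.List.Relation.Unary.Any using (here; there)
open import Relation.Binary.PropositionalEquality using (_≡_; refl; sym; trans; cong; subst)
open import Relation.Nullary using (¬_)
open import Data.Product using (_×_; _,_)
open import Data.Sum using (_⊎_; inj₁; inj₂)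

data HasZeroOrOpposites (xs : List ℤ) : Set where
  zero-entry       : 0ℤ ∈ xs → HasZeroOrOpposites xs
  opposite-entries : ∀ {a} → a ∈ xs → - a ∈ xs → HasZeroOrOpposites xs

IsCSSet⇒¬HasZeroOrOpposites : ∀ {xs} → IsCSSet xs → ¬ HasZeroOrOpposites xs
IsCSSet⇒¬HasZeroOrOpposites cs (zero-entry 0∈xs)         = IsCSSet.nonzero cs 0∈xs refl
IsCSSet⇒¬HasZeroOrOpposites cs (opposite-entries a∈ -a∈) = IsCSSet.noOpposite cs a∈ -a∈

IsCSSet⇒sumℤ≡0⇒cubeSum≡0 : ∀ {xs} → IsCSSet xs → sumℤ xs ≡ 0ℤ → sumℤ (map cube xs) ≡ 0ℤ
IsCSSet⇒sumℤ≡0⇒cubeSum≡0 cs s≡0 = trans (IsCSSet.cubeSum cs) (cong square s≡0)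

3*x*y*z≡0⇒x≡0∨y≡0∨z≡0 : ∀ x y z → + 3 * (x * (y * z)) ≡ 0ℤ → x ≡ 0ℤ ⊎ y ≡ 0ℤ ⊎ z ≡ 0ℤ
3*x*y*z≡0⇒x≡0∨y≡0∨z≡0 x y z eq with i*j≡0⇒i≡0∨j≡0 (+ 3) eq
... | inj₁ ()
... | inj₂ xyz≡0 with i*j≡0⇒i≡0∨j≡0 x xyz≡0
...   | inj₁ x≡0  = inj₁ x≡0
...   | inj₂ yz≡0 = inj₂ (i*j≡0⇒i≡0∨j≡0 y yz≡0)

-- The last entry is eliminated through the vanishing sum; the remaining ring identity is spelt
-- out because the solver does not unfold cube and sumℤ.
cubeSum₃ : ∀ a b c → sumℤ (a ∷ b ∷ c ∷ []) ≡ 0ℤ →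
           sumℤ (map cube (a ∷ b ∷ c ∷ [])) ≡ + 3 * (a * (b * c))
cubeSum₃ a b c s≡0 = subst (λ c → sumℤ (map cube (a ∷ b ∷ c ∷ [])) ≡ + 3 * (a * (b * c)))
  (sym c≡-[a+b]) (identity a b)
  where
  c≡-[a+b] : c ≡ - (a + b)
  c≡-[a+b] = inverseʳ-unique (a + b) c (trans (reassoc a b c) s≡0)
    where reassoc : ∀ a b c → (a + b) + c ≡ a + (b + (c + 0ℤ))
          reassoc = solve-∀
  identity : ∀ a b → a * a * a + (b * b * b + ((- (a + b)) * (- (a + b)) * (- (a + b)) + 0ℤ))
                     ≡ + 3 * (a * (b * - (a + b)))
  identity = solve-∀

cubeSum₄ : ∀ a b c d → sumℤ (a ∷ b ∷ c ∷ d ∷ []) ≡ 0ℤ →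
           sumℤ (map cube (a ∷ b ∷ c ∷ d ∷ [])) ≡ + 3 * ((a + b) * ((a + c) * (a + d)))
cubeSum₄ a b c d s≡0 =
  subst (λ d → sumℤ (map cube (a ∷ b ∷ c ∷ d ∷ [])) ≡ + 3 * ((a + b) * ((a + c) * (a + d))))
    (sym d≡-[a+b+c]) (identity a b c)
  where
  d≡-[a+b+c] : d ≡ - (a + b + c)
  d≡-[a+b+c] = inverseʳ-unique (a + b + c) d (trans (reassoc a b c d) s≡0)
    where reassoc : ∀ a b c d → (a + b + c) + d ≡ a + (b + (c + (d + 0ℤ)))
          reassoc = solve-∀
  identity : ∀ a b c →
    a * a * a + (b * b * b + (c * c * c + ((- (a + b + c)) * (- (a + b + c)) * (- (a + b + c)) + 0ℤ)))
      ≡ + 3 * ((a + b) * ((a + c) * (a + - (a + b + c))))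
  identity = solve-∀

x+y≡0⇒-x≡y : ∀ x y → x + y ≡ 0ℤ → - x ≡ y
x+y≡0⇒-x≡y x y x+y≡0 = sym (inverseʳ-unique x y x+y≡0)

zeroSum⇒HasZeroOrOpposites : ∀ xs → 1 ≤ length xs → length xs ≤ 4 →
  sumℤ xs ≡ 0ℤ → sumℤ (map cube xs) ≡ 0ℤ → HasZeroOrOpposites xs
zeroSum⇒HasZeroOrOpposites (a ∷ []) _ _ s≡0 _ =
  zero-entry (here (trans (sym s≡0) (+-identityʳ a)))
zeroSum⇒HasZeroOrOpposites (a ∷ b ∷ []) _ _ s≡0 _ =
  opposite-entries (here refl)
    (there (here (x+y≡0⇒-x≡y a b (trans (cong (λ t → a + t) (sym (+-identityʳ b))) s≡0))))
zeroSum⇒HasZeroOrOpposites (a ∷ b ∷ c ∷ []) _ _ s≡0 cubes≡0 =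
  zeroEntry (3*x*y*z≡0⇒x≡0∨y≡0∨z≡0 a b c (trans (sym (cubeSum₃ a b c s≡0)) cubes≡0))
  where
  zeroEntry : a ≡ 0ℤ ⊎ b ≡ 0ℤ ⊎ c ≡ 0ℤ → HasZeroOrOpposites (a ∷ b ∷ c ∷ [])
  zeroEntry (inj₁ a≡0)        = zero-entry (here (sym a≡0))
  zeroEntry (inj₂ (inj₁ b≡0)) = zero-entry (there (here (sym b≡0)))
  zeroEntry (inj₂ (inj₂ c≡0)) = zero-entry (there (there (here (sym c≡0))))
zeroSum⇒HasZeroOrOpposites (a ∷ b ∷ c ∷ d ∷ []) _ _ s≡0 cubes≡0 =
  oppositeEntries (3*x*y*z≡0⇒x≡0∨y≡0∨z≡0 (a + b) (a + c) (a + d) (trans (sym (cubeSum₄ a b c d s≡0)) cubes≡0))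
  where
  oppositeEntries : a + b ≡ 0ℤ ⊎ a + c ≡ 0ℤ ⊎ a + d ≡ 0ℤ → HasZeroOrOpposites (a ∷ b ∷ c ∷ d ∷ [])
  oppositeEntries (inj₁ a+b≡0)        = opposite-entries (here refl) (there (here (x+y≡0⇒-x≡y a b a+b≡0)))
  oppositeEntries (inj₂ (inj₁ a+c≡0)) = opposite-entries (here refl) (there (there (here (x+y≡0⇒-x≡y a c a+c≡0))))
  oppositeEntries (inj₂ (inj₂ a+d≡0)) = opposite-entries (here refl) (there (there (there (here (x+y≡0⇒-x≡y a d a+d≡0)))))
zeroSum⇒HasZeroOrOpposites (_ ∷ _ ∷ _ ∷ _ ∷ _ ∷ _) _ (s≤s (s≤s (s≤s (s≤s ())))) _ _

proposition6 : (n : ℕ) → 1 ≤ n → n ≤ 4 → (xs : List ℤ) →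
    ¬ (IsCSnSet n xs × sumℤ xs ≡ 0ℤ)
proposition6 n 1≤n n≤4 xs ((cs , refl) , s≡0) =
  IsCSSet⇒¬HasZeroOrOpposites cs
    (zeroSum⇒HasZeroOrOpposites xs 1≤n n≤4 s≡0 (IsCSSet⇒sumℤ≡0⇒cubeSum≡0 cs s≡0))
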